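{- Let $\ell\ge1$ and $t\ge1$ be fixed integers and let $F$ be a given $k\times p$ (0,1)-matrix. Let $t\cdot F=[F\,F\,\cdots\,F]$ be the concatenation of $t$ copies of $F$. Then $${\rm forb}\big(m,3,(\mathcal{T}_{\ell}(3)\setminus \mathcal{T}_{\ell}(2))\cup\{t\cdot F\}\big)=O\Big(\max\big\{m^{k},\ {\rm forb}\big(m,3,(\mathcal{T}_{\ell}(3)\setminus \mathcal{T}_{\ell}(2))\cup\{F\}\big)\big\}\Big).$$
   Context: An $r$-matrix is a matrix with entries in $\{0,1,\ldots,r-1\}$ (a (0,1)-matrix is a 2-matrix). A matrix is simple if it has no repeated columns. For matrices $G,A$ write $G\prec A$ if some submatrix of $A$ is a row and column permutation of $G$. For a finite family $\mathcal F$ of matrices, ${\rm forb}(m,r,\mathcal F)$ is the maximum number of columns of an $m$-rowed simple $r$-matrix $A$ with $G\not\prec A$ for all $G\in\mathcal F$. For distinct symbols $x,y$, $I_\ell(x,y)$ is the $\ell\times\ell$ matrix with $x$'s on the diagonal and $y$'s elsewhere, and $T_\ell(x,y)$ is the $\ell\times\ell$ matrix with $x$'s strictly below the diagonal and $y$'s on and above the diagonal. $\mathcal T_\ell(r)=\{I_\ell(x,y),\,T_\ell(x,y): x,y\in\{0,\ldots,r-1\},\,x\neq y\}$. -}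

module Defs where

open import Data.Nat using (ℕ; _≤_; _<_; _*_)
open import Data.Fin using (Fin; toℕ; inject₁; remainder)
open import Data.Fin.Properties using (_≟_)
open import Data.Product using (Σ; ∃; _×_)
open import Data.Sum using (_⊎_)
open import Data.Unit using (⊤)
open import Data.Bool using (if_then_else_)
open import Relation.Nullary using (¬_; does)
open import Relation.Binary.PropositionalEquality using (_≡_; _≢_)
open import Function.Definitions using (Injective)
open import Data.Nat using (_<ᵇ_)

Mat : ℕ → ℕ → ℕ → Set
Mat r a b = Fin a → Fin b → Fin r

Simple : ∀ {r a b} → Mat r a b → Set
Simple {a = a} {b} A = ∀ (j j' : Fin b) → (∀ (i : Fin a) → A i j ≡ A i j') → j ≡ j'

-- G ≺ A : some submatrix of A is a row and column permutation of G,
-- i.e. there are injective row and column maps embedding G in A.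
_≺_ : ∀ {r a b m n} → Mat r a b → Mat r m n → Set
_≺_ {r} {a} {b} {m} {n} G A =
  Σ (Fin a → Fin m) λ ρ → Σ (Fin b → Fin n) λ σ →
    Injective _≡_ _≡_ ρ × Injective _≡_ _≡_ σ ×
    (∀ i j → G i j ≡ A (ρ i) (σ j))

_≗₂_ : ∀ {r a b} → Mat r a b → Mat r a b → Set
G ≗₂ H = ∀ i j → G i j ≡ H i j

Iₘ : ∀ {r} ℓ → Fin r → Fin r → Mat r ℓ ℓ
Iₘ ℓ x y i j = if does (i ≟ j) then x else y

Tₘ : ∀ {r} ℓ → Fin r → Fin r → Mat r ℓ ℓ
Tₘ ℓ x y i j = if toℕ j <ᵇ toℕ i then x else y

In𝒯 : ℕ → ∀ ℓ → Mat 3 ℓ ℓ → Set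
In𝒯 s ℓ G = Σ (Fin 3) λ x → Σ (Fin 3) λ y →
  toℕ x < s × toℕ y < s × x ≢ y × (G ≗₂ Iₘ ℓ x y ⊎ G ≗₂ Tₘ ℓ x y)

InDiff : ∀ ℓ → Mat 3 ℓ ℓ → Set
InDiff ℓ G = In𝒯 3 ℓ G × ¬ In𝒯 2 ℓ G

embed : ∀ {a b} → Mat 2 a b → Mat 3 a b
embed F i j = inject₁ (F i j)

-- t·F = [F F ⋯ F]: column c of t·F is column (c mod p) of F.
copies : ∀ {k p} t → Mat 2 k p → Mat 2 k (t * p)
copies {p = p} t F i c = F i (remainder {t} p c)

Avoids : ∀ {a b} ℓ → Mat 3 a b → ∀ {m n} → Mat 3 m n → Set
Avoids ℓ H A = (∀ (G : Mat 3 ℓ ℓ) → InDiff ℓ G → ¬ (G ≺ A)) × ¬ (H ≺ A)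

-- f = forb(m,3,𝓕) where 𝓕 is given by its avoidance predicate Av:
-- f is attained by some simple m-rowed 3-matrix avoiding 𝓕, and bounds all such.
IsForb : ℕ → (∀ {m n} → Mat 3 m n → Set) → ℕ → Set
IsForb m Av f =
  (Σ ℕ λ n → Σ (Mat 3 m n) λ A → Simple A × Av A × n ≡ f) ×
  (∀ n (A : Mat 3 m n) → Simple A → Av A → n ≤ f)

module Submission where

-- Fix the k×p matrix G and a property P of m-rowed matrices
-- that survives deleting columns (here: avoiding 𝒯_ℓ(3) ∖ 𝒯_ℓ(2)), and let
-- f bound the number of columns of simple matrices with P that avoid G.
-- We show by induction on s: a simple matrix A with P having no s+1
-- column-disjoint copies of G on a common set of rows has at most
-- s·p·m^k + f columns.  For the step, every row map ρ : Fin k → Fin m that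
-- carries a copy of G gets one such copy selected; the selected columns L
-- number at most p·m^k.  Deleting L leaves a matrix with no s+1 disjoint
-- copies (otherwise the selected copy would make s+2 in A), so induction
-- applies to the rest.  Which row maps carry a copy is not decided
-- constructively; the selection is made under a double negation, which is
-- harmless since the conclusion n ≤ … is decidable.  Finally s+1 disjoint
-- copies on injective rows are exactly an occurrence of (s+1)·G, so the
-- theorem follows with C = 1 + s·p.

open import Defs
open import Data.Nat using (ℕ; zero; suc; _≤_; _*_; _^_; _⊔_; _+_; z≤n; s≤s; _≤?_)
open import Data.Nat.Properties
  using (≤-trans; m≤n⇒m≤1+n; +-monoʳ-≤; +-mono-≤; *-monoʳ-≤; m≤m⊔n; m≤n⊔m;
         +-comm; +-suc; m≤n+m; module ≤-Reasoning)
open import Data.Nat.Tactic.RingSolver using (solve-∀)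
open import Data.Fin using (Fin; zero; suc; remQuot; remainder; combine; lift; finToFun; funToFin)
open import Data.Fin.Properties using (combine-remQuot; lift-injective; finToFun-funToFin; suc-injective)
import Data.Fin.Properties as Fin
open import Data.Product using (Σ; _×_; _,_; proj₂; uncurry; map₁)
open import Data.Empty using (⊥-elim)
open import Data.List using (List; []; _∷_; _++_; length; map; tabulate; allFin)
open import Data.List.Properties using (length-++; length-map; length-tabulate)
open import Data.List.Relation.Unary.Any using (here; there; any?)
open import Data.List.Relation.Unary.Any.Properties using (++⁺ˡ; ++⁺ʳ)
open import Data.List.Relation.Unary.All using (All; []; _∷_)
import Data.List.Relation.Unary.All as All
open import Data.List.Membership.Propositional using (_∈_; _∉_)
open import Data.List.Membership.Propositional.Properties using (∈-tabulate⁺; ∈-map⁺; ∈-allFin)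
open import Relation.Nullary using (¬_; yes; no)
open import Relation.Nullary.Decidable using (decidable-stable; ¬¬-excluded-middle)
open import Relation.Binary.PropositionalEquality
open import Function.Base using (id; _∘_)
open import Function.Definitions using (Injective)

restrictCols : ∀ {r m n n'} → Mat r m n → (Fin n' → Fin n) → Mat r m n'
restrictCols A τ i j = A i (τ j)

simple-restrict : ∀ {r m n n'} (A : Mat r m n) {τ : Fin n' → Fin n} →
  Injective _≡_ _≡_ τ → Simple A → Simple (restrictCols A τ)
simple-restrict A τ-inj simpleA j j' same = τ-inj (simpleA _ _ same)

≺-restrict : ∀ {r a b m n n'} (G : Mat r a b) (A : Mat r m n) {τ : Fin n' → Fin n} →
  Injective _≡_ _≡_ τ → G ≺ restrictCols A τ → G ≺ A
≺-restrict G A τ-inj (ρ , σ , ρ-inj , σ-inj , match) =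
  ρ , _ , ρ-inj , σ-inj ∘ τ-inj , match

Complement : ∀ n → List (Fin n) → Set
Complement n L = Σ ℕ λ n' → Σ (Fin n' → Fin n) λ τ →
  Injective _≡_ _≡_ τ × n ≤ n' + length L × (∀ j → τ j ∉ L)

shiftDown : ∀ {n} → List (Fin (suc n)) → List (Fin n)
shiftDown [] = []
shiftDown (zero ∷ L) = shiftDown L
shiftDown (suc c ∷ L) = c ∷ shiftDown L

shiftDown-∈ : ∀ {n} {c : Fin n} (L : List (Fin (suc n))) → suc c ∈ L → c ∈ shiftDown L
shiftDown-∈ (zero ∷ L) (there c∈L) = shiftDown-∈ L c∈L
shiftDown-∈ (suc c ∷ L) (here refl) = here refl
shiftDown-∈ (suc c ∷ L) (there c∈L) = there (shiftDown-∈ L c∈L)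

shiftDown-length : ∀ {n} (L : List (Fin (suc n))) → length (shiftDown L) ≤ length L
shiftDown-length [] = z≤n
shiftDown-length (zero ∷ L) = m≤n⇒m≤1+n (shiftDown-length L)
shiftDown-length (suc c ∷ L) = s≤s (shiftDown-length L)

shiftDown-length-zero : ∀ {n} (L : List (Fin (suc n))) → zero ∈ L →
  suc (length (shiftDown L)) ≤ length L
shiftDown-length-zero (zero ∷ L) _ = s≤s (shiftDown-length L)
shiftDown-length-zero (suc c ∷ L) (there 0∈L) = s≤s (shiftDown-length-zero L 0∈L)

-- Induction on n: delete the shifted list from Fin n, then put column
-- zero back unless it belongs to L.
complement : ∀ n (L : List (Fin n)) → Complement n L
complement zero L = 0 , (λ ()) , (λ { {()} }) , z≤n , (λ ())
complement (suc n) L with complement n (shiftDown L) | any? (zero Fin.≟_) L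
... | n' , τ , τ-inj , n≤ , avoids | yes 0∈L =
  n' , suc ∘ τ , τ-inj ∘ suc-injective , bound , λ j → avoids j ∘ shiftDown-∈ L
  where
  bound : suc n ≤ n' + length L
  bound = begin
    suc n                             ≤⟨ s≤s n≤ ⟩
    suc (n' + length (shiftDown L))   ≡⟨ +-suc n' _ ⟨
    n' + suc (length (shiftDown L))   ≤⟨ +-monoʳ-≤ n' (shiftDown-length-zero L 0∈L) ⟩
    n' + length L                     ∎
    where open ≤-Reasoning
... | n' , τ , τ-inj , n≤ , avoids | no 0∉L =
  suc n' , lift 1 τ , lift-injective τ τ-inj 1 ,
  s≤s (≤-trans n≤ (+-monoʳ-≤ n' (shiftDown-length L))) , avoidsL
  where
  avoidsL : ∀ j → lift 1 τ j ∉ L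
  avoidsL zero = 0∉L
  avoidsL (suc j) = avoids j ∘ shiftDown-∈ L

remQuot-injective : ∀ {t} p → Injective _≡_ _≡_ (remQuot {t} p)
remQuot-injective {t} p {c} {c'} same = begin
  c                                    ≡⟨ combine-remQuot {t} p c ⟨
  uncurry combine (remQuot {t} p c)    ≡⟨ cong (uncurry combine) same ⟩
  uncurry combine (remQuot {t} p c')   ≡⟨ combine-remQuot {t} p c' ⟩
  c'                                   ∎
  where open ≡-Reasoning

sum≤scaledMax : ∀ a x y → a * x + y ≤ suc a * (x ⊔ y)
sum≤scaledMax a x y = begin
  a * x + y              ≤⟨ +-mono-≤ (*-monoʳ-≤ a (m≤m⊔n x y)) (m≤n⊔m x y) ⟩
  a * (x ⊔ y) + (x ⊔ y)  ≡⟨ +-comm (a * (x ⊔ y)) _ ⟩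
  suc a * (x ⊔ y)        ∎
  where open ≤-Reasoning

module Copies {r k p m : ℕ} (G : Mat r k p) where

  CopyAt : ∀ {n} → Mat r m n → (Fin k → Fin m) → (Fin p → Fin n) → Set
  CopyAt A ρ σ = ∀ i c → G i c ≡ A (ρ i) (σ c)

  DisjointCopies : ∀ {n} → ℕ → Mat r m n → (Fin k → Fin m) → Set
  DisjointCopies {n} t A ρ = Σ (Fin t → Fin p → Fin n) λ σ →
    Injective _≡_ _≡_ (uncurry σ) × (∀ q → CopyAt A ρ (σ q))

  NoDisjointCopies : ∀ {n} → ℕ → Mat r m n → Set
  NoDisjointCopies t A = ∀ ρ → Injective _≡_ _≡_ ρ → ¬ DisjointCopies t A ρ

  concat-≺ : ∀ {n} t (A : Mat r m n) {ρ} → Injective _≡_ _≡_ ρ →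
    DisjointCopies t A ρ → (λ i c → G i (remainder {t} p c)) ≺ A
  concat-≺ t A ρ-inj (σ , σ-inj , copies) =
    _ , uncurry σ ∘ remQuot p , ρ-inj , remQuot-injective p ∘ σ-inj ,
    λ i c → copies _ i _

  noCopy⇒avoids : ∀ {n} (A : Mat r m n) → NoDisjointCopies 1 A → ¬ G ≺ A
  noCopy⇒avoids A none (ρ , σ , ρ-inj , σ-inj , match) =
    none ρ ρ-inj ((λ _ → σ) , pair-inj , λ { zero → match })
    where
    pair-inj : Injective _≡_ _≡_ (uncurry λ (_ : Fin 1) → σ)
    pair-inj {zero , c} {zero , c'} same = cong (zero ,_) (σ-inj same)

  copyAt-rows : ∀ {n} (A : Mat r m n) {ρ ρ' σ} → (∀ i → ρ i ≡ ρ' i) →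
    CopyAt A ρ σ → CopyAt A ρ' σ
  copyAt-rows A {σ = σ} ρ≗ρ' copy i c = trans (copy i c) (cong (λ x → A x (σ c)) (ρ≗ρ' i))

  HasCopy : ∀ {n} → Mat r m n → (Fin k → Fin m) → Set
  HasCopy {n} A ρ = Σ (Fin p → Fin n) λ σ → Injective _≡_ _≡_ σ × CopyAt A ρ σ

  CopyWithin : ∀ {n} → Mat r m n → (Fin k → Fin m) → List (Fin n) → Set
  CopyWithin {n} A ρ L = Σ (Fin p → Fin n) λ σ →
    Injective _≡_ _≡_ σ × CopyAt A ρ σ × (∀ c → σ c ∈ L)

  within-++ : ∀ {n} {A : Mat r m n} {ρ} L' {L} → CopyWithin A ρ L → CopyWithin A ρ (L' ++ L)
  within-++ L' (σ , σ-inj , copy , σ∈L) = σ , σ-inj , copy , ++⁺ʳ L' ∘ σ∈L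

  Covers : ∀ {n} → Mat r m n → List (Fin k → Fin m) → List (Fin n) → Set
  Covers A ρs L = All (λ ρ → HasCopy A ρ → CopyWithin A ρ L) ρs

  -- Greedy selection: p columns per row map make a cover.  Whether a row
  -- map carries a copy is only decided classically, hence the ¬¬.
  cover : ∀ {n} (A : Mat r m n) ρs →
    ¬ ¬ (Σ (List (Fin n)) λ L → length L ≤ length ρs * p × Covers A ρs L)
  cover A [] found = found ([] , z≤n , [])
  cover A (ρ ∷ ρs) found = cover A ρs λ (L , |L|≤ , covers) → ¬¬-excluded-middle {A = HasCopy A ρ} λ
    { (yes (σ , σ-inj , copy)) →
        found (tabulate σ ++ L , grown σ L |L|≤ ,
               (λ _ → σ , σ-inj , copy , ++⁺ˡ ∘ ∈-tabulate⁺) ∷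
               All.map (within-++ {A = A} (tabulate σ) ∘_) covers)
    ; (no none) → found (L , ≤-trans |L|≤ (m≤n+m _ p) , (⊥-elim ∘ none) ∷ covers) }
    where
    grown : ∀ {n} (σ : Fin p → Fin n) L → length L ≤ length ρs * p →
      length (tabulate σ ++ L) ≤ suc (length ρs) * p
    grown σ L |L|≤ = begin
      length (tabulate σ ++ L)           ≡⟨ length-++ (tabulate σ) ⟩
      length (tabulate σ) + length L     ≡⟨ cong (_+ length L) (length-tabulate σ) ⟩
      p + length L                       ≤⟨ +-monoʳ-≤ p |L|≤ ⟩
      p + length ρs * p                  ∎
      where open ≤-Reasoning

  -- All m^k row maps, each represented up to pointwise equality.
  rowMaps : List (Fin k → Fin m)
  rowMaps = map (finToFun {m} {k}) (allFin (m ^ k))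

  length-rowMaps : length rowMaps ≡ m ^ k
  length-rowMaps = trans (length-map (finToFun {m} {k}) (allFin (m ^ k))) (length-tabulate {n = m ^ k} id)

  extend : ∀ {n n' t} (A : Mat r m n) {τ : Fin n' → Fin n} {L ρ} →
    Injective _≡_ _≡_ τ → (∀ j → τ j ∉ L) →
    CopyWithin A ρ L → DisjointCopies t (restrictCols A τ) ρ → DisjointCopies (suc t) A ρ
  extend {n} {t = t} A {τ} {L} {ρ} τ-inj avoids (σ₀ , σ₀-inj , copy₀ , σ₀∈L) (σ , σ-inj , copies) =
    σ' , σ'-inj , copies'
    where
    σ' : Fin (suc t) → Fin p → Fin n
    σ' zero = σ₀
    σ' (suc q) = τ ∘ σ q
    σ'-inj : Injective _≡_ _≡_ (uncurry σ')
    σ'-inj {zero , c} {zero , c'} same = cong (zero ,_) (σ₀-inj same)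
    σ'-inj {zero , c} {suc q' , c'} same = ⊥-elim (avoids (σ q' c') (subst (_∈ L) same (σ₀∈L c)))
    σ'-inj {suc q , c} {zero , c'} same = ⊥-elim (avoids (σ q c) (subst (_∈ L) (sym same) (σ₀∈L c')))
    σ'-inj {suc q , c} {suc q' , c'} same = cong (map₁ suc) (σ-inj (τ-inj same))
    copies' : ∀ q → CopyAt A ρ (σ' q)
    copies' zero = copy₀
    copies' (suc q) = copies q

  drop-cover : ∀ {n n' t} (A : Mat r m n) {τ : Fin n' → Fin n} {L} →
    Injective _≡_ _≡_ τ → (∀ j → τ j ∉ L) → Covers A rowMaps L →
    NoDisjointCopies (suc (suc t)) A → NoDisjointCopies (suc t) (restrictCols A τ)
  drop-cover A {τ} τ-inj avoids covers none ρ ρ-inj copies@(σ , σ-inj , copyAt) =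
    none ρ ρ-inj (extend A τ-inj avoids (back (covered (τ ∘ σ zero , first-inj , forth))) copies)
    where
    listed : ∀ i → finToFun (funToFin ρ) i ≡ ρ i
    listed = finToFun-funToFin ρ
    covered : HasCopy A (finToFun (funToFin ρ)) → CopyWithin A (finToFun (funToFin ρ)) _
    covered = All.lookup covers (∈-map⁺ (finToFun {m} {k}) (∈-allFin (funToFin ρ)))
    first-inj : Injective _≡_ _≡_ (τ ∘ σ zero)
    first-inj same = cong proj₂ (σ-inj (τ-inj same))
    forth : CopyAt A (finToFun (funToFin ρ)) (τ ∘ σ zero)
    forth = copyAt-rows A (sym ∘ listed) (copyAt zero)
    back : CopyWithin A (finToFun (funToFin ρ)) _ → CopyWithin A ρ _
    back (σ₀ , σ₀-inj , copy₀ , σ₀∈L) = σ₀ , σ₀-inj , copyAt-rows A listed copy₀ , σ₀∈L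

  module CopyBound {P : ∀ {n} → Mat r m n → Set}
    (P-restrict : ∀ {n n'} (A : Mat r m n) {τ : Fin n' → Fin n} →
                  Injective _≡_ _≡_ τ → P A → P (restrictCols A τ))
    (f : ℕ) (bound : ∀ n (A : Mat r m n) → Simple A → P A → ¬ G ≺ A → n ≤ f) where

    copiesBound : ∀ s n (A : Mat r m n) → Simple A → P A → NoDisjointCopies (suc s) A →
      n ≤ s * p * m ^ k + f
    copiesBound zero n A simpleA pA none = bound n A simpleA pA (noCopy⇒avoids A none)
    copiesBound (suc s) n A simpleA pA none = decidable-stable (n ≤? _) λ n≰ →
      cover A rowMaps λ (L , |L|≤ , covers) → n≰ (deleteCover L |L|≤ covers (complement n L))
      where
      deleteCover : ∀ L → length L ≤ length rowMaps * p → Covers A rowMaps L →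
        Complement n L → n ≤ suc s * p * m ^ k + f
      deleteCover L |L|≤ covers (n' , τ , τ-inj , n≤ , avoids) = begin
        n                                         ≤⟨ n≤ ⟩
        n' + length L                             ≤⟨ +-mono-≤ rest |L|≤ ⟩
        (s * p * m ^ k + f) + length rowMaps * p  ≡⟨ cong (λ N → s * p * m ^ k + f + N * p) length-rowMaps ⟩
        (s * p * m ^ k + f) + m ^ k * p           ≡⟨ rearrange s p (m ^ k) f ⟩
        suc s * p * m ^ k + f                     ∎
        where
        open ≤-Reasoning
        rearrange : ∀ a b N c → a * b * N + c + N * b ≡ suc a * b * N + c
        rearrange = solve-∀
        rest : n' ≤ s * p * m ^ k + f
        rest = copiesBound s n' (restrictCols A τ) (simple-restrict A τ-inj simpleA)
                 (P-restrict A τ-inj pA) (drop-cover A τ-inj avoids covers none)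

AvoidsDiff : ∀ ℓ {m n} → Mat 3 m n → Set
AvoidsDiff ℓ A = ∀ (G : Mat 3 ℓ ℓ) → InDiff ℓ G → ¬ (G ≺ A)

avoidsDiff-restrict : ∀ ℓ {m n n'} (A : Mat 3 m n) {τ : Fin n' → Fin n} →
  Injective _≡_ _≡_ τ → AvoidsDiff ℓ A → AvoidsDiff ℓ (restrictCols A τ)
avoidsDiff-restrict ℓ A τ-inj avoids G G∈ = avoids G G∈ ∘ ≺-restrict G A τ-inj

forbCopiesBound : ∀ ℓ s {k p} (F : Mat 2 k p) m f → IsForb m (Avoids ℓ (embed F)) f →
  ∀ g → IsForb m (Avoids ℓ (embed (copies (suc s) F))) g → g ≤ s * p * m ^ k + f
forbCopiesBound ℓ s F m f (_ , boundF) g ((n , A , simpleA , (avoidsT , noCopies) , refl) , _) =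
  copiesBound s n A simpleA avoidsT
    (λ ρ ρ-inj disjoint → noCopies (concat-≺ (suc s) A ρ-inj disjoint))
  where
  open Copies {m = m} (embed F)
  open CopyBound (avoidsDiff-restrict ℓ) f (λ n A simpleA pA noF → boundF n A simpleA (pA , noF))

-- t = 0 is excluded by hypothesis; for t = s + 1 the constant is C = 1 + s·p.
mainTheorem10 : (ℓ t k p : ℕ) → 1 ≤ ℓ → 1 ≤ t → (F : Mat 2 k p) →
    Σ ℕ λ C → Σ ℕ λ M → ∀ m → M ≤ m →
    ∀ f → IsForb m (Avoids ℓ (embed F)) f →
    ∀ g → IsForb m (Avoids ℓ (embed (copies t F))) g →
    g ≤ C * ((m ^ k) ⊔ f)
mainTheorem10 ℓ zero k p _ () F
mainTheorem10 ℓ (suc s) k p _ _ F =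
  suc (s * p) , 0 , λ m _ f forbF g forbG →
    ≤-trans (forbCopiesBound ℓ s F m f forbF g forbG) (sum≤scaledMax (s * p) (m ^ k) f)
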